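{- Let $G$ be a $(C_3,C_5,C_6)$-free graph, $R\in\mathsf{MinRed}(G)$ and $x\in\mathsf{red}(R)$. Then $|\mathsf{red}(R)\cap N(x)|\leq 2$ and $|\mathsf{red}(R)\cap N^2(x)|\leq 1$.
   Context: Graphs are finite, simple, undirected; $N(v),N[v]$ are open/closed neighborhoods and $N^2(x)$ is the set of vertices at distance exactly $2$ from $x$. For $I\subseteq V(G)$ and $v\in I$, $\mathsf{priv}(v,I)=\{z\in N[v]:N[z]\cap I=\{v\}\}$. $I$ is irredundant if every element has nonempty $\mathsf{priv}$, redundant otherwise. $\mathsf{MinRed}(G)$ is the family of inclusion-wise minimal redundant sets; for redundant $R$, $\mathsf{red}(R)=\{v\in R:\mathsf{priv}(v,R)=\emptyset\}$. $(C_3,C_5,C_6)$-free means no induced cycle of length 3, 5 or 6. -}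

module Defs where

open import Data.Nat using (ℕ; suc; _%_; _+_; NonZero)
open import Data.Bool using (Bool; true; false; _∧_; _∨_; not)
open import Data.Fin using (Fin; toℕ)
open import Data.Fin.Properties using (_≟_)
open import Data.Fin.Subset using (Subset; _∈_; _⊆_; _∩_; ∣_∣)
open import Data.Vec using (tabulate; lookup)
open import Data.Bool.ListAction using (all; any)
open import Data.List.Base using (allFin)
open import Data.Product using (_×_)
open import Data.Empty using (⊥)
open import Function.Bundles using (_⇔_)
open import Function.Definitions using (Injective)
open import Relation.Nullary using (¬_)
open import Relation.Nullary.Decidable using (⌊_⌋)
open import Relation.Binary.PropositionalEquality using (_≡_)

record Graph : Set where
  field
    n      : ℕ
    adj    : Fin n → Fin n → Bool
    sym    : ∀ u v → adj u v ≡ adj v u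
    irrefl : ∀ v → adj v v ≡ false
open Graph public

module _ (G : Graph) where
  private V = Fin (n G)

  eqB : V → V → Bool
  eqB u v = ⌊ u ≟ v ⌋

  closedB : V → V → Bool
  closedB v z = eqB v z ∨ adj G v z

  N : V → Subset (n G)
  N x = tabulate (λ y → adj G x y)

  N² : V → Subset (n G)
  N² x = tabulate (λ y → not (eqB x y) ∧ not (adj G x y)
                          ∧ any (λ w → adj G x w ∧ adj G w y) (allFin (n G)))

  -- z ∈ priv(v, I)  iff  z ∈ N[v] and N[z] ∩ I = {v}
  privB : Subset (n G) → V → V → Bool
  privB I v z = closedB v z
    ∧ all (λ w → eqB' (lookup I w ∧ closedB z w) (eqB w v)) (allFin (n G))
    where
      eqB' : Bool → Bool → Bool
      eqB' true  b = b
      eqB' false b = not b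

  hasPriv : Subset (n G) → V → Bool
  hasPriv I v = any (privB I v) (allFin (n G))

  Irredundant : Subset (n G) → Set
  Irredundant I = ∀ v → v ∈ I → hasPriv I v ≡ true

  Redundant : Subset (n G) → Set
  Redundant I = ¬ Irredundant I

  MinRed : Subset (n G) → Set
  MinRed R = Redundant R × (∀ S → S ⊆ R → ¬ (S ≡ R) → Irredundant S)

  red : Subset (n G) → Subset (n G)
  red R = tabulate (λ v → lookup R v ∧ not (hasPriv R v))

  -- G contains an induced cycle of length k (k ≥ 3 intended):
  -- an injective map c : Fin k → V such that c i, c j are adjacent
  -- exactly when i, j are cyclically consecutive.
  cycAdj : ∀ {k} .⦃ _ : NonZero k ⦄ → Fin k → Fin k → Set
  cycAdj {k} i j = (toℕ j ≡ (toℕ i + 1) % k) Data.Sum.⊎ (toℕ i ≡ (toℕ j + 1) % k)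
    where import Data.Sum

  HasInducedCycle : (k : ℕ) .⦃ _ : NonZero k ⦄ → Set
  HasInducedCycle k = Data.Product.Σ (Fin k → V) λ c →
    Injective _≡_ _≡_ c × (∀ i j → (adj G (c i) (c j) ≡ true) ⇔ cycAdj i j)
    where import Data.Product

  C₃C₅C₆-free : Set
  C₃C₅C₆-free = ¬ HasInducedCycle 3 × ¬ HasInducedCycle 5 × ¬ HasInducedCycle 6

-- If R is minimal redundant, v ∈ red(R) and u ∈ R ∖ {v}, then R − u is irredundant, so v has a
-- private neighbour z with respect to R − u; since v has none with respect to R, z must see u,
-- and N[z] ∩ R ⊆ {u, v}.  For non-adjacent u, v this z is a common neighbour of u and v adjacent
-- to no other vertex of R.  Three pairwise non-adjacent vertices of R, two of them red, together
-- with their three common neighbours form an induced 6-cycle.  Three red neighbours of x are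
-- pairwise non-adjacent because G has no triangle; two red vertices y, y′ at distance two from a
-- red x are non-adjacent, since otherwise x, y, y′ and the common neighbours of x with y and with
-- y′ form an induced 5-cycle, and then x, y, y′ is such an independent triple.

module Submission where

open import Defs renaming (sym to adj-sym)
open import Data.Nat using (_≤_)
open import Data.Product using (_×_)
open import Data.Fin.Subset using (_∈_; _∩_; ∣_∣)

open import Data.Bool using (Bool; true; false; T; _∧_; not)
open import Data.Bool.Properties using (T-≡; T-∧; T-∨; T-not-≡; ¬-not)
open import Data.Bool.ListAction using (any)
open import Data.Empty using (⊥; ⊥-elim)
open import Data.Fin using (Fin; zero; suc; toℕ)
open import Data.Fin.Properties using (_≟_; <-cmp; all?; any?; suc-injective)
open import Data.Fin.Subset using (Subset; inside; outside; Empty; _-_)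
open import Data.Fin.Subset.Properties
  using (Empty-unique; ∣⊥∣≡0; x∈p∩q⁻; p─q⊆p; x∈p∧x≢y⇒x∈p-y; x∈p⇒p-x⊂p)
open import Data.List.Base using (allFin)
open import Data.List.Membership.Propositional.Properties using (∈-allFin)
import Data.List.Relation.Unary.All as All
open import Data.List.Relation.Unary.All.Properties using (all⁺; all⁻; ¬All⇒Any¬)
open import Data.List.Relation.Unary.Any using (satisfied)
open import Data.List.Relation.Unary.Any.Properties using (any⁺; any⁻)
import Data.List.Relation.Unary.Any.Properties as Any
open import Data.Nat using (ℕ; suc; _+_; _%_; NonZero; z≤n; s≤s)
import Data.Nat as ℕ
open import Data.Nat.Properties using (<⇒<ᵇ; ≤-reflexive)
open import Data.Product using (∃-syntax; _,_; proj₁; proj₂)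
import Data.Product as Product
open import Data.Sum using (_⊎_; inj₁; inj₂)
import Data.Sum as Sum
open import Data.Vec using (lookup; tabulate; []; _∷_; here; there)
open import Data.Vec.Properties using ([]=⇒lookup; lookup⇒[]=; lookup∘tabulate)
open import Function.Base using (_∘_)
open import Function.Bundles using (_⇔_; mk⇔; Equivalence)
open import Relation.Binary.Definitions using (tri<; tri≈; tri>)
open import Relation.Binary.PropositionalEquality
  using (_≡_; _≢_; refl; sym; trans; subst; cong; ≢-sym)
open import Relation.Nullary using (¬_; Dec; yes; no; does; contradiction)
open import Relation.Nullary.Decidable
  using (_⊎-dec_; _×-dec_; _→-dec_; ¬?; T?; from-yes; dec-false; does-⇔; toWitness; fromWitness)

open Equivalence using (to; from)

≡does⇒⇔ : ∀ {p} {P : Set p} {b} (P? : Dec P) → b ≡ does P? → b ≡ true ⇔ P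
≡does⇒⇔ (yes p) b≡true  = mk⇔ (λ _ → p) (λ _ → b≡true)
≡does⇒⇔ (no ¬p) b≡false = mk⇔ (λ b≡true → contradiction (trans (sym b≡false) b≡true) λ ()) (λ p → contradiction p ¬p)

∈⇔T-lookup : ∀ {m} {p : Subset m} {x} → x ∈ p ⇔ T (lookup p x)
∈⇔T-lookup {p = p} {x} = mk⇔ (from T-≡ ∘ []=⇒lookup) (lookup⇒[]= x p ∘ to T-≡)

∈-tabulate⁻ : ∀ {m} {f : Fin m → Bool} {x} → x ∈ tabulate f → T (f x)
∈-tabulate⁻ {f = f} {x} = subst T (lookup∘tabulate f x) ∘ to ∈⇔T-lookup

Empty⇒∣p∣≡0 : ∀ {m} {p : Subset m} → Empty p → ∣ p ∣ ≡ 0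
Empty⇒∣p∣≡0 {m} empty = trans (cong ∣_∣ (Empty-unique empty)) (∣⊥∣≡0 m)

no-distinct-pair⇒∣p∣≤1 : ∀ {m} {p : Subset m} →
                          (∀ {x y} → x ∈ p → y ∈ p → x ≢ y → ⊥) → ∣ p ∣ ≤ 1
no-distinct-pair⇒∣p∣≤1 {p = []}          _ = z≤n
no-distinct-pair⇒∣p∣≤1 {p = inside ∷ p}  h =
  s≤s (≤-reflexive (Empty⇒∣p∣≡0 λ (x , x∈p) → h here (there x∈p) λ ()))
no-distinct-pair⇒∣p∣≤1 {p = outside ∷ p} h =
  no-distinct-pair⇒∣p∣≤1 λ x∈p y∈p x≢y → h (there x∈p) (there y∈p) (x≢y ∘ suc-injective)

no-distinct-triple⇒∣p∣≤2 : ∀ {m} {p : Subset m} →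
                           (∀ {x y z} → x ∈ p → y ∈ p → z ∈ p → x ≢ y → x ≢ z → y ≢ z → ⊥) → ∣ p ∣ ≤ 2
no-distinct-triple⇒∣p∣≤2 {p = []}          _ = z≤n
no-distinct-triple⇒∣p∣≤2 {p = inside ∷ p}  h =
  s≤s (no-distinct-pair⇒∣p∣≤1 λ x∈p y∈p x≢y → h here (there x∈p) (there y∈p) (λ ()) (λ ()) (x≢y ∘ suc-injective))
no-distinct-triple⇒∣p∣≤2 {p = outside ∷ p} h =
  no-distinct-triple⇒∣p∣≤2 λ x∈p y∈p z∈p x≢y x≢z y≢z →
    h (there x∈p) (there y∈p) (there z∈p) (x≢y ∘ suc-injective) (x≢z ∘ suc-injective) (y≢z ∘ suc-injective)

x∈p⇒p-x≢p : ∀ {m} {p : Subset m} {x} → x ∈ p → p - x ≢ p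
x∈p⇒p-x≢p {p = p} x∈p p-x≡p with proj₂ (x∈p⇒p-x⊂p x∈p)
... | y , y∈p , y∉p-x = y∉p-x (subst (y ∈_) (sym p-x≡p) y∈p)

module GraphTheory (G : Graph) where
  private V = Fin (n G)

  infix 4 _~_ _≁_ _∈N[_]

  _~_ _≁_ : V → V → Set
  u ~ v = adj G u v ≡ true
  u ≁ v = adj G u v ≡ false

  _∈N[_] : V → V → Set
  z ∈N[ v ] = v ≡ z ⊎ v ~ z

  adj-comm : ∀ {u v} {b} → adj G u v ≡ b → adj G v u ≡ b
  adj-comm {u} {v} = trans (adj-sym G v u)

  ~⇒≢ : ∀ {u v} → u ~ v → u ≢ v
  ~⇒≢ {u} u~v refl = contradiction (trans (sym (irrefl G u)) u~v) λ ()

  ≁⇒¬~ : ∀ {u v} → u ≁ v → ¬ u ~ v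
  ≁⇒¬~ u≁v u~v = contradiction (trans (sym u≁v) u~v) λ ()

  ∈N[]-sym : ∀ {v z} → z ∈N[ v ] → v ∈N[ z ]
  ∈N[]-sym = Sum.map sym adj-comm

  ∈N[]⇒~ : ∀ {v z} → v ≢ z → z ∈N[ v ] → v ~ z
  ∈N[]⇒~ v≢z (inj₁ v≡z) = contradiction v≡z v≢z
  ∈N[]⇒~ _   (inj₂ v~z) = v~z

  T-eqB : ∀ {u v} → T (eqB G u v) ⇔ u ≡ v
  T-eqB = mk⇔ toWitness fromWitness

  T-closedB : ∀ {v z} → T (closedB G v z) ⇔ z ∈N[ v ]
  T-closedB = mk⇔ (Sum.map (to T-eqB) (to T-≡) ∘ to T-∨) (from T-∨ ∘ Sum.map (from T-eqB) (from T-≡))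

  cycAdj? : ∀ {k} .⦃ _ : NonZero k ⦄ (i j : Fin k) → Dec (cycAdj G i j)
  cycAdj? {k} i j = toℕ j ℕ.≟ (toℕ i + 1) % k ⊎-dec toℕ i ℕ.≟ (toℕ j + 1) % k

  cycAdj-sym : ∀ {k} .⦃ _ : NonZero k ⦄ {i j : Fin k} → cycAdj G i j → cycAdj G j i
  cycAdj-sym = Sum.swap

  CycAdjIrreflexive : (k : ℕ) .⦃ _ : NonZero k ⦄ → Set
  CycAdjIrreflexive k = ∀ (i : Fin k) → ¬ cycAdj G i i

  -- Separation is what forces a map realising the cycle pattern to be injective.  It fails
  -- for k = 4, whose pattern is also realised by walking back and forth along a single edge.
  Separating : (k : ℕ) .⦃ _ : NonZero k ⦄ → Set
  Separating k = ∀ (i j : Fin k) → i ≢ j → ∃[ l ] cycAdj G i l × ¬ cycAdj G j l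

  cycAdjIrreflexive? : ∀ k .⦃ _ : NonZero k ⦄ → Dec (CycAdjIrreflexive k)
  cycAdjIrreflexive? k = all? λ i → ¬? (cycAdj? i i)

  separating? : ∀ k .⦃ _ : NonZero k ⦄ → Dec (Separating k)
  separating? k = all? λ i → all? λ j → ¬? (i ≟ j) →-dec any? λ l → cycAdj? i l ×-dec ¬? (cycAdj? j l)

  -- Only the pairs i < j are asked for, in the form T (i <ᵇ j), so that for a concrete k every
  -- impossible pair is refuted by a single absurd pattern.
  induced-cycle : ∀ {k} .⦃ _ : NonZero k ⦄ → CycAdjIrreflexive k → Separating k → (c : Fin k → V) →
                  (∀ i j → T (toℕ i ℕ.<ᵇ toℕ j) → adj G (c i) (c j) ≡ does (cycAdj? i j)) →
                  HasInducedCycle G k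
  induced-cycle irreflexive separating c upper = c , injective , adjacency
    where
    realised : ∀ i j → adj G (c i) (c j) ≡ does (cycAdj? i j)
    realised i j with <-cmp i j
    ... | tri< i<j _ _  = upper i j (<⇒<ᵇ i<j)
    ... | tri≈ _ refl _ = trans (irrefl G (c i)) (sym (dec-false (cycAdj? i i) (irreflexive i)))
    ... | tri> _ _ j<i  = adj-comm (trans (upper j i (<⇒<ᵇ j<i))
                                          (does-⇔ (mk⇔ cycAdj-sym cycAdj-sym) (cycAdj? j i) (cycAdj? i j)))
    adjacency : ∀ i j → c i ~ c j ⇔ cycAdj G i j
    adjacency i j = ≡does⇒⇔ (cycAdj? i j) (realised i j)
    injective : ∀ {i j} → c i ≡ c j → i ≡ j
    injective {i} {j} ci≡cj with i ≟ j
    ... | yes i≡j = i≡j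
    ... | no i≢j with separating i j i≢j
    ...   | l , il , ¬jl = contradiction (to (adjacency j l) (subst (_~ c l) ci≡cj (from (adjacency i l) il))) ¬jl

  triangle : ∀ {v₀ v₁ v₂} → v₀ ~ v₁ → v₁ ~ v₂ → v₂ ~ v₀ → HasInducedCycle G 3
  triangle {v₀} {v₁} {v₂} e₀₁ e₁₂ e₂₀ =
    induced-cycle (from-yes (cycAdjIrreflexive? 3)) (from-yes (separating? 3)) c upper
    where
    c : Fin 3 → V
    c = lookup (v₀ ∷ v₁ ∷ v₂ ∷ [])
    upper : ∀ i j → T (toℕ i ℕ.<ᵇ toℕ j) → adj G (c i) (c j) ≡ does (cycAdj? i j)
    upper zero       (suc zero)       _ = e₀₁
    upper zero       (suc (suc zero)) _ = adj-comm e₂₀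
    upper (suc zero) (suc (suc zero)) _ = e₁₂
    upper _                 zero             ()
    upper (suc _)           (suc zero)       ()
    upper (suc (suc _))     (suc (suc zero)) ()

  pentagon : ∀ {v₀ v₁ v₂ v₃ v₄} →
             v₀ ~ v₁ → v₁ ~ v₂ → v₂ ~ v₃ → v₃ ~ v₄ → v₄ ~ v₀ →
             v₀ ≁ v₂ → v₀ ≁ v₃ → v₁ ≁ v₃ → v₁ ≁ v₄ → v₂ ≁ v₄ →
             HasInducedCycle G 5
  pentagon {v₀} {v₁} {v₂} {v₃} {v₄} e₀₁ e₁₂ e₂₃ e₃₄ e₄₀ n₀₂ n₀₃ n₁₃ n₁₄ n₂₄ =
    induced-cycle (from-yes (cycAdjIrreflexive? 5)) (from-yes (separating? 5)) c upper
    where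
    c : Fin 5 → V
    c = lookup (v₀ ∷ v₁ ∷ v₂ ∷ v₃ ∷ v₄ ∷ [])
    upper : ∀ i j → T (toℕ i ℕ.<ᵇ toℕ j) → adj G (c i) (c j) ≡ does (cycAdj? i j)
    upper zero             (suc zero)                   _ = e₀₁
    upper zero             (suc (suc zero))             _ = n₀₂
    upper zero             (suc (suc (suc zero)))       _ = n₀₃
    upper zero             (suc (suc (suc (suc zero)))) _ = adj-comm e₄₀
    upper (suc zero)       (suc (suc zero))             _ = e₁₂
    upper (suc zero)       (suc (suc (suc zero)))       _ = n₁₃
    upper (suc zero)       (suc (suc (suc (suc zero)))) _ = n₁₄
    upper (suc (suc zero)) (suc (suc (suc zero)))       _ = e₂₃
    upper (suc (suc zero)) (suc (suc (suc (suc zero)))) _ = n₂₄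
    upper (suc (suc (suc zero))) (suc (suc (suc (suc zero)))) _ = e₃₄
    upper _                       zero                         ()
    upper (suc _)                 (suc zero)                   ()
    upper (suc (suc _))           (suc (suc zero))             ()
    upper (suc (suc (suc _)))     (suc (suc (suc zero)))       ()
    upper (suc (suc (suc (suc _)))) (suc (suc (suc (suc zero)))) ()

  hexagon : ∀ {v₀ v₁ v₂ v₃ v₄ v₅} →
            v₀ ~ v₁ → v₁ ~ v₂ → v₂ ~ v₃ → v₃ ~ v₄ → v₄ ~ v₅ → v₅ ~ v₀ →
            v₀ ≁ v₂ → v₀ ≁ v₃ → v₀ ≁ v₄ → v₁ ≁ v₃ → v₁ ≁ v₄ → v₁ ≁ v₅ → v₂ ≁ v₄ → v₂ ≁ v₅ → v₃ ≁ v₅ →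
            HasInducedCycle G 6
  hexagon {v₀} {v₁} {v₂} {v₃} {v₄} {v₅} e₀₁ e₁₂ e₂₃ e₃₄ e₄₅ e₅₀ n₀₂ n₀₃ n₀₄ n₁₃ n₁₄ n₁₅ n₂₄ n₂₅ n₃₅ =
    induced-cycle (from-yes (cycAdjIrreflexive? 6)) (from-yes (separating? 6)) c upper
    where
    c : Fin 6 → V
    c = lookup (v₀ ∷ v₁ ∷ v₂ ∷ v₃ ∷ v₄ ∷ v₅ ∷ [])
    upper : ∀ i j → T (toℕ i ℕ.<ᵇ toℕ j) → adj G (c i) (c j) ≡ does (cycAdj? i j)
    upper zero (suc zero)                               _ = e₀₁
    upper zero (suc (suc zero))                         _ = n₀₂
    upper zero (suc (suc (suc zero)))                   _ = n₀₃
    upper zero (suc (suc (suc (suc zero))))             _ = n₀₄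
    upper zero (suc (suc (suc (suc (suc zero)))))       _ = adj-comm e₅₀
    upper (suc zero) (suc (suc zero))                   _ = e₁₂
    upper (suc zero) (suc (suc (suc zero)))             _ = n₁₃
    upper (suc zero) (suc (suc (suc (suc zero))))       _ = n₁₄
    upper (suc zero) (suc (suc (suc (suc (suc zero))))) _ = n₁₅
    upper (suc (suc zero)) (suc (suc (suc zero)))             _ = e₂₃
    upper (suc (suc zero)) (suc (suc (suc (suc zero))))       _ = n₂₄
    upper (suc (suc zero)) (suc (suc (suc (suc (suc zero))))) _ = n₂₅
    upper (suc (suc (suc zero))) (suc (suc (suc (suc zero))))       _ = e₃₄
    upper (suc (suc (suc zero))) (suc (suc (suc (suc (suc zero))))) _ = n₃₅
    upper (suc (suc (suc (suc zero)))) (suc (suc (suc (suc (suc zero))))) _ = e₄₅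
    upper _                             zero                               ()
    upper (suc _)                       (suc zero)                         ()
    upper (suc (suc _))                 (suc (suc zero))                   ()
    upper (suc (suc (suc _)))           (suc (suc (suc zero)))             ()
    upper (suc (suc (suc (suc _))))     (suc (suc (suc (suc zero))))       ()
    upper (suc (suc (suc (suc (suc _))))) (suc (suc (suc (suc (suc zero))))) ()

  triangle-free⇒≁ : ¬ HasInducedCycle G 3 → ∀ {u v w} → u ~ v → v ~ w → u ≁ w
  triangle-free⇒≁ ¬C₃ u~v v~w = ¬-not λ u~w → ¬C₃ (triangle u~v v~w (adj-comm u~w))

  IsPrivate : Subset (n G) → V → V → Set
  IsPrivate I v z = z ∈N[ v ] × (∀ {w} → w ∈ I → w ∈N[ z ] → w ≡ v)

  -- The test privB applies to each w is a local function of Defs that cannot be named here,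
  -- so its value is only reached by with-abstracting its first argument lookup I w ∧ closedB G z w.
  privB-sound : ∀ {I v z} → T (privB G I v z) → IsPrivate I v z
  privB-sound {I} {v} {z} priv with to (T-∧ {closedB G v z}) priv
  ... | z∈Nv , entries = to T-closedB z∈Nv , only
    where
    only : ∀ {w} → w ∈ I → w ∈N[ z ] → w ≡ v
    only {w} w∈I w∈Nz with lookup I w ∧ closedB G z w in eq
                         | All.lookup (all⁺ _ (allFin (n G)) entries) (∈-allFin w)
    ... | true  | w≟v = to T-eqB w≟v
    ... | false | _   = ⊥-elim (subst T eq (from T-∧ (to ∈⇔T-lookup w∈I , from T-closedB w∈Nz)))

  ¬privB⇒other-neighbour : ∀ {I v z} → v ∈ I → z ∈N[ v ] → ¬ T (privB G I v z) →
                           ∃[ w ] w ∈ I × w ∈N[ z ] × w ≢ v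
  ¬privB⇒other-neighbour {I} {v} {z} v∈I z∈Nv ¬priv
    with satisfied (¬All⇒Any¬ (λ _ → T? _) (allFin (n G))
                     (¬priv ∘ from (T-∧ {closedB G v z}) ∘ (from T-closedB z∈Nv ,_) ∘ all⁻ _))
  ... | w , ¬entry with lookup I w ∧ closedB G z w in eq | ¬entry
  ...   | true  | w≢v = w , from ∈⇔T-lookup (proj₁ w∈I∩Nz) , to T-closedB (proj₂ w∈I∩Nz) , w≢v ∘ from T-eqB
    where
    w∈I∩Nz : T (lookup I w) × T (closedB G z w)
    w∈I∩Nz = to T-∧ (subst T (sym eq) _)
  ...   | false | ¬w≢v with w ≟ v
  ...     | yes refl = ⊥-elim (subst T eq (from T-∧ (to ∈⇔T-lookup v∈I , from T-closedB (∈N[]-sym z∈Nv))))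
  ...     | no _     = ⊥-elim (¬w≢v _)

  irredundant⇒private : ∀ {I v} → Irredundant G I → v ∈ I → ∃[ z ] IsPrivate I v z
  irredundant⇒private {v = v} irr v∈I =
    Product.map₂ privB-sound (satisfied (any⁻ _ (allFin (n G)) (from T-≡ (irr v v∈I))))

  ∈-red⁻ : ∀ {R v} → v ∈ red G R → v ∈ R × (∀ z → ¬ T (privB G R v z))
  ∈-red⁻ {R} {v} v∈red = from ∈⇔T-lookup (proj₁ red∧) , no-private
    where
    red∧ : T (lookup R v) × T (not (hasPriv G R v))
    red∧ = to T-∧ (∈-tabulate⁻ v∈red)
    no-private : ∀ z → ¬ T (privB G R v z)
    no-private z priv = subst T (to T-not-≡ (proj₂ red∧)) (any⁺ _ (Any.tabulate⁺ z priv))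

  SharedNeighbour : Subset (n G) → V → V → Set
  SharedNeighbour R v u = ∃[ z ] z ∈N[ v ] × u ∈N[ z ] × (∀ {w} → w ∈ R → w ∈N[ z ] → w ≡ v ⊎ w ≡ u)

  minRed⇒shared-neighbour : ∀ {R v u} → MinRed G R → v ∈ red G R → u ∈ R → u ≢ v → SharedNeighbour R v u
  minRed⇒shared-neighbour {R} {v} {u} (_ , minimal) v∈red u∈R u≢v
    with ∈-red⁻ v∈red
  ... | v∈R , not-private
    with irredundant⇒private (minimal (R - u) (p─q⊆p R _) (x∈p⇒p-x≢p u∈R)) (x∈p∧x≢y⇒x∈p-y v∈R (≢-sym u≢v))
  ... | z , z∈Nv , only-v
    with ¬privB⇒other-neighbour v∈R z∈Nv (not-private z)
  ... | w , w∈R , w∈Nz , w≢v = z , z∈Nv , subst (_∈N[ z ]) w≡u w∈Nz , sees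
    where
    sees : ∀ {w} → w ∈ R → w ∈N[ z ] → w ≡ v ⊎ w ≡ u
    sees {w} w∈R w∈Nz with w ≟ u
    ... | yes w≡u = inj₂ w≡u
    ... | no  w≢u = inj₁ (only-v (x∈p∧x≢y⇒x∈p-y w∈R w≢u) w∈Nz)
    w≡u : w ≡ u
    w≡u = Sum.fromInj₂ (λ w≡v → contradiction w≡v w≢v) (sees w∈R w∈Nz)

  record CommonNeighbour (R : Subset (n G)) (v u : V) : Set where
    field
      vertex  : V
      adjˡ    : v ~ vertex
      adjʳ    : vertex ~ u
      ≁-others : ∀ {w} → w ∈ R → w ≢ v → w ≢ u → vertex ≁ w

  shared⇒common-neighbour : ∀ {R v u} → v ≢ u → v ≁ u → SharedNeighbour R v u → CommonNeighbour R v u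
  shared⇒common-neighbour {v = v} {u} v≢u v≁u (z , z∈Nv , u∈Nz , sees) = record
    { vertex   = z
    ; adjˡ     = ∈N[]⇒~ v≢z z∈Nv
    ; adjʳ     = ∈N[]⇒~ z≢u u∈Nz
    ; ≁-others = λ w∈R w≢v w≢u → ¬-not λ z~w → Sum.[ w≢v , w≢u ] (sees w∈R (inj₂ z~w))
    }
    where
    v≢z : v ≢ z
    v≢z refl = ≁⇒¬~ v≁u (∈N[]⇒~ v≢u u∈Nz)
    z≢u : z ≢ u
    z≢u refl = ≁⇒¬~ v≁u (∈N[]⇒~ v≢u z∈Nv)

  common-neighbour : ∀ {R v u} → MinRed G R → v ∈ red G R → u ∈ R → v ≢ u → v ≁ u → CommonNeighbour R v u
  common-neighbour minRed v∈red u∈R v≢u v≁u =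
    shared⇒common-neighbour v≢u v≁u (minRed⇒shared-neighbour minRed v∈red u∈R (≢-sym v≢u))

  ∈N⁻ : ∀ {x y} → y ∈ N G x → x ~ y
  ∈N⁻ = to T-≡ ∘ ∈-tabulate⁻

  ∈N²⁻ : ∀ {x y} → y ∈ N² G x → x ≢ y × x ≁ y
  ∈N²⁻ {x} {y} y∈N²x = (λ x≡y → subst T (to T-not-≡ (proj₁ N²∧)) (from T-eqB x≡y))
                     , to T-not-≡ (proj₁ (to (T-∧ {not (adj G x y)}) (proj₂ N²∧)))
    where
    N²∧ : T (not (eqB G x y)) × T (not (adj G x y) ∧ any (λ w → adj G x w ∧ adj G w y) (allFin (n G)))
    N²∧ = to T-∧ (∈-tabulate⁻ y∈N²x)

module _ (G : Graph) (free : C₃C₅C₆-free G) (R : Subset (n G)) (minRed : MinRed G R) where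
  open GraphTheory G
  open CommonNeighbour

  private
    ¬C₃ : ¬ HasInducedCycle G 3
    ¬C₃ = proj₁ free
    ¬C₅ : ¬ HasInducedCycle G 5
    ¬C₅ = proj₁ (proj₂ free)
    ¬C₆ : ¬ HasInducedCycle G 6
    ¬C₆ = proj₂ (proj₂ free)

  no-independent-triple : ∀ {p q r} → p ∈ red G R → q ∈ red G R → r ∈ R →
                          p ≢ q → q ≢ r → p ≢ r → p ≁ q → q ≁ r → p ≁ r → ⊥
  no-independent-triple {p} {q} {r} p∈red q∈red r∈R p≢q q≢r p≢r p≁q q≁r p≁r =
    ¬C₆ (hexagon (adjˡ a) (adjʳ a) (adjˡ b) (adjʳ b) (adj-comm (adjʳ c)) (adj-comm (adjˡ c))
                 p≁q (adj-comm (≁-others b p∈R p≢q p≢r)) p≁r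
                 (triangle-free⇒≁ ¬C₃ (adjʳ a) (adjˡ b))
                 (≁-others a r∈R (≢-sym p≢r) (≢-sym q≢r))
                 (triangle-free⇒≁ ¬C₃ (adj-comm (adjˡ a)) (adjˡ c))
                 q≁r
                 (adj-comm (≁-others c q∈R (≢-sym p≢q) q≢r))
                 (triangle-free⇒≁ ¬C₃ (adjʳ b) (adj-comm (adjʳ c))))
    where
    p∈R : p ∈ R
    p∈R = proj₁ (∈-red⁻ p∈red)
    q∈R : q ∈ R
    q∈R = proj₁ (∈-red⁻ q∈red)
    a : CommonNeighbour R p q
    a = common-neighbour minRed p∈red q∈R p≢q p≁q
    b : CommonNeighbour R q r
    b = common-neighbour minRed q∈red r∈R q≢r q≁r
    c : CommonNeighbour R p r
    c = common-neighbour minRed p∈red r∈R p≢r p≁r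

  red-non-neighbours-independent : ∀ {x y y′} → x ∈ red G R → y ∈ R → y′ ∈ R →
                                   x ≢ y → x ≢ y′ → x ≁ y → x ≁ y′ → y ≁ y′
  red-non-neighbours-independent {x} {y} {y′} x∈red y∈R y′∈R x≢y x≢y′ x≁y x≁y′ = ¬-not λ y~y′ →
    ¬C₅ (pentagon (adjˡ a) (adjʳ a) y~y′ (adj-comm (adjʳ a′)) (adj-comm (adjˡ a′))
                  x≁y x≁y′
                  (≁-others a y′∈R (≢-sym x≢y′) (≢-sym (~⇒≢ y~y′)))
                  (triangle-free⇒≁ ¬C₃ (adj-comm (adjˡ a)) (adjˡ a′))
                  (adj-comm (≁-others a′ y∈R (≢-sym x≢y) (~⇒≢ y~y′))))
    where
    a : CommonNeighbour R x y
    a = common-neighbour minRed x∈red y∈R x≢y x≁y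
    a′ : CommonNeighbour R x y′
    a′ = common-neighbour minRed x∈red y′∈R x≢y′ x≁y′

  ∣red∩N∣≤2 : ∀ x → ∣ red G R ∩ N G x ∣ ≤ 2
  ∣red∩N∣≤2 x = no-distinct-triple⇒∣p∣≤2 λ y₁∈ y₂∈ y₃∈ y₁≢y₂ y₁≢y₃ y₂≢y₃ →
    no-independent-triple (∈red y₁∈) (∈red y₂∈) (proj₁ (∈-red⁻ (∈red y₃∈))) y₁≢y₂ y₂≢y₃ y₁≢y₃
                          (apart y₁∈ y₂∈) (apart y₂∈ y₃∈) (apart y₁∈ y₃∈)
    where
    ∈red : ∀ {y} → y ∈ red G R ∩ N G x → y ∈ red G R
    ∈red = proj₁ ∘ x∈p∩q⁻ (red G R) (N G x)
    x~ : ∀ {y} → y ∈ red G R ∩ N G x → x ~ y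
    x~ = ∈N⁻ ∘ proj₂ ∘ x∈p∩q⁻ (red G R) (N G x)
    apart : ∀ {y y′} → y ∈ red G R ∩ N G x → y′ ∈ red G R ∩ N G x → y ≁ y′
    apart y∈ y′∈ = triangle-free⇒≁ ¬C₃ (adj-comm (x~ y∈)) (x~ y′∈)

  ∣red∩N²∣≤1 : ∀ {x} → x ∈ red G R → ∣ red G R ∩ N² G x ∣ ≤ 1
  ∣red∩N²∣≤1 {x} x∈red = no-distinct-pair⇒∣p∣≤1 λ y₁∈ y₂∈ y₁≢y₂ →
    let y₁∈red , y₁∈N²x = x∈p∩q⁻ (red G R) (N² G x) y₁∈
        y₂∈red , y₂∈N²x = x∈p∩q⁻ (red G R) (N² G x) y₂∈
        x≢y₁ , x≁y₁ = ∈N²⁻ y₁∈N²x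
        x≢y₂ , x≁y₂ = ∈N²⁻ y₂∈N²x
        y₂∈R = proj₁ (∈-red⁻ y₂∈red)
        y₁≁y₂ = red-non-neighbours-independent x∈red (proj₁ (∈-red⁻ y₁∈red)) y₂∈R x≢y₁ x≢y₂ x≁y₁ x≁y₂
    in no-independent-triple x∈red y₁∈red y₂∈R x≢y₁ y₁≢y₂ x≢y₂ x≁y₁ y₁≁y₂ x≁y₂

lemma20 : (G : Graph) → C₃C₅C₆-free G → (R : _) → MinRed G R → (x : _) → x ∈ red G R →
    (∣ red G R ∩ N G x ∣ ≤ 2) × (∣ red G R ∩ N² G x ∣ ≤ 1)
lemma20 G free R minRed x x∈red = ∣red∩N∣≤2 G free R minRed x , ∣red∩N²∣≤1 G free R minRed x∈red
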